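{- Let $x$ and $y$ be rational numbers with $0<x<y<1$, and let $p$ be a prime such that $x-1,\,y-1\in\mathbb{Z}_p^\times$. Write $x-1=\sum_{j\ge0}x_j(p)p^j$ and $y-1=\sum_{j\ge0}y_j(p)p^j$ for the $p$-adic expansions (digits in $\{0,\dots,p-1\}$). Let $D$ be the least common multiple of the denominators of $x$ and $y$. If $p>D$, then $x_j(p)\neq y_j(p)$ for all $j\ge 0$.
   Context: $\mathbb{Z}_p^\times$ denotes the units of the ring of $p$-adic integers. -}

module Defs where

open import Data.Nat as ℕ using (ℕ; zero; suc; _^_)
open import Data.Integer as ℤ using (ℤ; +_)
open import Data.Integer.Divisibility as ℤD using ()
open import Data.Rational using (ℚ; ↥_; ↧ₙ_)
open import Data.Product using (_×_)

partialSum : ℕ → (ℕ → ℕ) → ℕ → ℕ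
partialSum p d zero    = 0
partialSum p d (suc n) = partialSum p d n ℕ.+ d n ℕ.* p ^ n

-- d is the p-adic digit expansion of q (q assumed to have denominator prime to p):
-- every digit lies in {0,…,p-1} and q ≡ Σ_{j<n} d j p^j  (mod p^n ℤ_p) for all n,
-- i.e. p^n divides  num(q) - den(q) * Σ_{j<n} d j p^j  in ℤ.
IsPAdicExpansion : ℕ → ℚ → (ℕ → ℕ) → Set
IsPAdicExpansion p q d =
  (∀ j → d j ℕ.< p) ×
  (∀ n → (+ (p ^ n)) ℤD.∣ ((↥ q) ℤ.- (+ (↧ₙ q)) ℤ.* (+ partialSum p d n)))

IsPAdicUnit : ℕ → ℚ → Set
IsPAdicUnit p q = (¬ (p ℕD.∣ ℤ.∣ ↥ q ∣)) × (¬ (p ℕD.∣ (↧ₙ q)))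
  where
  open import Data.Nat.Divisibility as ℕD using ()
  open import Relation.Nullary using (¬_)

module Submission where

-- Write x - 1 = -kₓ/D and y - 1 = -k_y/D with D = lcm(den x, den y), so that
-- 1 ≤ k_y < kₓ ≤ D < p (the strict inequality because x < y).  For a rational
-- -k/D with 1 ≤ k ≤ D whose p-adic digits are d, the "carries"
--     W n = (D · Σ_{i<n} d i pⁱ + k) / pⁿ
-- are natural numbers satisfying  p · W (n+1) = W n + D · d n,  W 0 = k, and
-- they stay in [1, D].  This recursion can be read in both directions:
--   * forwards, W n is the unique residue below p of -D · d n, so equal
--     digits at position j force equal carries at position j (uses D < p);
--   * backwards, W n is the unique residue in [1, D] of p · W (n+1), so equal
--     carries at position n+1 force equal carries at position n.

module Carries where

  open import Defs using (partialSum)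
  open import Data.Nat
  open import Data.Nat.Properties
  open import Data.Nat.DivMod using (_%_; m<n⇒m%n≡m; [m+kn]%n≡m%n)
  open import Data.Nat.Divisibility using (_∣_)
  open import Data.Product using (_×_; _,_; proj₂)
  open import Relation.Binary.PropositionalEquality
  open import Data.Nat.Solver using (module +-*-Solver)
  open +-*-Solver using (solve; _:+_; _:*_; _:=_)

  residue-unique : ∀ {a b c} u v → a < c → b < c → a + u * c ≡ b + v * c → a ≡ b
  residue-unique {a} {b} {c@(suc _)} u v a<c b<c eq = begin
    a                 ≡⟨ sym (m<n⇒m%n≡m a<c) ⟩
    a % c             ≡⟨ sym ([m+kn]%n≡m%n a u c) ⟩
    (a + u * c) % c   ≡⟨ cong (_% c) eq ⟩
    (b + v * c) % c   ≡⟨ [m+kn]%n≡m%n b v c ⟩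
    b % c             ≡⟨ m<n⇒m%n≡m b<c ⟩
    b                 ∎
    where open ≡-Reasoning

  complement-unique : ∀ {a b c p A B} → a < p → b < p →
                      a + c ≡ p * A → b + c ≡ p * B → a ≡ b
  complement-unique {a} {b} {c} {p} {A} {B} a<p b<p ea eb =
    residue-unique B A a<p b<p (+-cancelʳ-≡ c _ _ (begin
      a + B * p + c   ≡⟨ solve 4 (λ a c B p → a :+ B :* p :+ c := (a :+ c) :+ B :* p) refl a c B p ⟩
      (a + c) + B * p ≡⟨ cong (_+ B * p) ea ⟩
      p * A + B * p   ≡⟨ solve 3 (λ p A B → p :* A :+ B :* p := p :* B :+ A :* p) refl p A B ⟩
      p * B + A * p   ≡⟨ cong (_+ A * p) (sym eb) ⟩
      (b + c) + A * p ≡⟨ solve 4 (λ b c A p → (b :+ c) :+ A :* p := b :+ A :* p :+ c) refl b c A p ⟩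
      b + A * p + c   ∎))
    where open ≡-Reasoning

  InRange : ℕ → ℕ → Set
  InRange D w = 1 ≤ w × w ≤ D

  in-range-unique : ∀ {D a b} u v → InRange D a → InRange D b →
                    a + D * u ≡ b + D * v → a ≡ b
  in-range-unique {D} {suc a} {suc b} u v (_ , a<D) (_ , b<D) eq =
    cong suc (residue-unique u v a<D b<D (suc-injective (begin
      suc a + u * D ≡⟨ cong (suc a +_) (*-comm u D) ⟩
      suc a + D * u ≡⟨ eq ⟩
      suc b + D * v ≡⟨ cong (suc b +_) (*-comm D v) ⟩
      suc b + v * D ∎)))
    where open ≡-Reasoning

  factor-positive : ∀ p {w t} → p * w ≡ t → 1 ≤ t → 1 ≤ w
  factor-positive p {zero} p*0≡t 1≤t
    with () ← subst (1 ≤_) (trans (sym p*0≡t) (*-zeroʳ p)) 1≤t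
  factor-positive p {suc w} _ _ = s≤s z≤n

  module _ (p D : ℕ) .{{_ : NonZero p}} where

    -- W is a carry sequence for the digits d of -W 0 / D in base p.
    IsCarry : (ℕ → ℕ) → (ℕ → ℕ) → Set
    IsCarry W d = ∀ n → p * W (suc n) ≡ W n + D * d n

    -- With digits below p, the carries never leave [1, D]:
    -- p · W (n+1) = W n + D · d n lies in [1, p · D].
    carry-in-range : ∀ {W d} → IsCarry W d → (∀ j → d j < p) →
                     InRange D (W 0) → ∀ n → InRange D (W n)
    carry-in-range step digit<p start zero = start
    carry-in-range {W} {d} step digit<p start (suc n)
      with carry-in-range step digit<p start n
    ... | 1≤W , W≤D = positive , bounded
      where
      positive : 1 ≤ W (suc n)
      positive = factor-positive p (step n) (≤-trans 1≤W (m≤m+n (W n) (D * d n)))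
      bounded : W (suc n) ≤ D
      bounded = *-cancelˡ-≤ p (begin
        p * W (suc n)  ≡⟨ step n ⟩
        W n + D * d n  ≤⟨ +-monoˡ-≤ (D * d n) W≤D ⟩
        D + D * d n    ≡⟨ sym (*-suc D (d n)) ⟩
        D * suc (d n)  ≤⟨ *-monoʳ-≤ D (digit<p n) ⟩
        D * p          ≡⟨ *-comm D p ⟩
        p * D          ∎)
        where open ≤-Reasoning

    module CarriesOf (k : ℕ) (d : ℕ → ℕ)
                     (divisible : ∀ n → p ^ n ∣ D * partialSum p d n + k) where

      carry : ℕ → ℕ
      carry n = _∣_.quotient (divisible n)

      carry-spec : ∀ n → D * partialSum p d n + k ≡ carry n * p ^ n
      carry-spec n = _∣_.equality (divisible n)

      carry-start : carry 0 ≡ k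
      carry-start = begin
        carry 0      ≡⟨ sym (*-identityʳ (carry 0)) ⟩
        carry 0 * 1  ≡⟨ sym (carry-spec 0) ⟩
        D * 0 + k    ≡⟨ cong (_+ k) (*-zeroʳ D) ⟩
        k            ∎
        where open ≡-Reasoning

      carry-step : IsCarry carry d
      carry-step n = *-cancelʳ-≡ _ _ (p ^ n) {{m^n≢0 p n}} (begin
        p * carry (suc n) * p ^ n         ≡⟨ solve 3 (λ p w e → p :* w :* e := w :* (p :* e)) refl p (carry (suc n)) (p ^ n) ⟩
        carry (suc n) * p ^ suc n         ≡⟨ sym (carry-spec (suc n)) ⟩
        D * (S + d n * p ^ n) + k         ≡⟨ solve 5 (λ D S e q k → D :* (S :+ e :* q) :+ k := (D :* S :+ k) :+ D :* e :* q) refl D S (d n) (p ^ n) k ⟩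
        (D * S + k) + D * d n * p ^ n     ≡⟨ cong (_+ D * d n * p ^ n) (carry-spec n) ⟩
        carry n * p ^ n + D * d n * p ^ n ≡⟨ sym (*-distribʳ-+ (p ^ n) (carry n) (D * d n)) ⟩
        (carry n + D * d n) * p ^ n       ∎)
        where
        open ≡-Reasoning
        S = partialSum p d n

    module _ {W W′ d d′ : ℕ → ℕ}
             (step : IsCarry W d) (step′ : IsCarry W′ d′)
             (range : ∀ n → InRange D (W n)) (range′ : ∀ n → InRange D (W′ n)) where

      -- Forwards: when D < p, W j is the residue below p of -D · d j.
      same-digit⇒same-carry : D < p → ∀ j → d j ≡ d′ j → W j ≡ W′ j
      same-digit⇒same-carry D<p j dj≡d′j =
        complement-unique (≤-<-trans (proj₂ (range j)) D<p)
                          (≤-<-trans (proj₂ (range′ j)) D<p)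
                          (sym (step j))
                          (trans (cong (λ e → W′ j + D * e) dj≡d′j) (sym (step′ j)))

      -- Backwards: W n is the residue in [1, D] of p · W (n+1).
      same-next⇒same-carry : ∀ n → W (suc n) ≡ W′ (suc n) → W n ≡ W′ n
      same-next⇒same-carry n eq = in-range-unique (d n) (d′ n) (range n) (range′ n) (begin
        W n + D * d n    ≡⟨ sym (step n) ⟩
        p * W (suc n)    ≡⟨ cong (p *_) eq ⟩
        p * W′ (suc n)   ≡⟨ step′ n ⟩
        W′ n + D * d′ n  ∎)
        where open ≡-Reasoning

      same-carry⇒same-start : ∀ n → W n ≡ W′ n → W 0 ≡ W′ 0
      same-carry⇒same-start zero    eq = eq
      same-carry⇒same-start (suc n) eq = same-carry⇒same-start n (same-next⇒same-carry n eq)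

    common-digit⇒same-numerator :
      D < p → ∀ {k k′ d d′} → InRange D k → InRange D k′ →
      (∀ j → d j < p) → (∀ j → d′ j < p) →
      (∀ n → p ^ n ∣ D * partialSum p d n + k) →
      (∀ n → p ^ n ∣ D * partialSum p d′ n + k′) →
      ∀ j → d j ≡ d′ j → k ≡ k′
    common-digit⇒same-numerator D<p {k} {k′} {d} {d′} k∈ k′∈ d<p d′<p divs divs′ j dj≡d′j = begin
      k          ≡⟨ sym X.carry-start ⟩
      X.carry 0  ≡⟨ same-carry⇒same-start X.carry-step Y.carry-step range range′ j carries-agree ⟩
      Y.carry 0  ≡⟨ Y.carry-start ⟩
      k′         ∎
      where
      open ≡-Reasoning
      module X = CarriesOf k d divs
      module Y = CarriesOf k′ d′ divs′
      range : ∀ n → InRange D (X.carry n)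
      range = carry-in-range X.carry-step d<p (subst (InRange D) (sym X.carry-start) k∈)
      range′ : ∀ n → InRange D (Y.carry n)
      range′ = carry-in-range Y.carry-step d′<p (subst (InRange D) (sym Y.carry-start) k′∈)
      carries-agree : X.carry j ≡ Y.carry j
      carries-agree = same-digit⇒same-carry X.carry-step Y.carry-step range range′ D<p j dj≡d′j

module Deficits where

  open import Defs using (partialSum; IsPAdicExpansion)
  open import Data.Nat as ℕ using (ℕ; suc; _^_; s≤s; z≤n)
  import Data.Nat.Properties as ℕP
  open import Data.Nat.Divisibility using (_∣_; divides; ∣-trans; ∣n⇒∣m*n)
  open import Data.Integer as ℤ using (ℤ; +_; -[1+_]; +<+)
  import Data.Integer.Properties as ℤP
  open import Data.Integer.GCD using (gcd)
  open import Data.Rational using (ℚ; _<_; _-_; -_; 0ℚ; 1ℚ; ↥_; ↧_; ↧ₙ_)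
  open import Data.Rational.Properties using (drop-*<*; ↧-+; +-monoˡ-<)
  open import Data.Product using (∃; _,_)
  open import Relation.Binary.PropositionalEquality
  open import Data.Nat.Solver using (module +-*-Solver)
  open +-*-Solver using (solve; _:+_; _:*_; _:=_)
  open Carries using (InRange; factor-positive)

  negative-numerator : ∀ r → r < 0ℚ → ∃ λ a → ↥ r ≡ -[1+ a ]
  negative-numerator r r<0 = numerator-shape (subst (ℤ._< + 0) (ℤP.*-identityʳ (↥ r)) (drop-*<* r<0))
    where
    numerator-shape : ∀ {z} → z ℤ.< + 0 → ∃ λ a → z ≡ -[1+ a ]
    numerator-shape { -[1+ a ]} _ = a , refl
    numerator-shape {+ n} (+<+ ())

  numerator-below-denominator : ∀ r {a} → - 1ℚ < r → ↥ r ≡ -[1+ a ] → suc a ℕ.< ↧ₙ r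
  numerator-below-denominator r r>-1 num≡ = ℤP.drop‿+<+ (ℤP.neg-cancel-<
    (subst₂ ℤ._<_ (ℤP.-1*i≡-i (↧ r)) (trans (ℤP.*-identityʳ (↥ r)) num≡) (drop-*<* r>-1)))

  denominator-of-shift : ∀ x → ↧ₙ (x - 1ℚ) ∣ ↧ₙ x
  denominator-of-shift x = divides ℤ.∣ g ∣ (begin
      ↧ₙ x                          ≡⟨ sym (ℕP.*-identityʳ (↧ₙ x)) ⟩
      ℤ.∣ ↧ x ℤ.* + 1 ∣             ≡⟨ cong ℤ.∣_∣ (sym (↧-+ x (- 1ℚ))) ⟩
      ℤ.∣ ↧ (x - 1ℚ) ℤ.* g ∣        ≡⟨ ℤP.abs-* (↧ (x - 1ℚ)) g ⟩
      ↧ₙ (x - 1ℚ) ℕ.* ℤ.∣ g ∣       ≡⟨ ℕP.*-comm (↧ₙ (x - 1ℚ)) _ ⟩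
      ℤ.∣ g ∣ ℕ.* ↧ₙ (x - 1ℚ)       ∎)
    where
    open ≡-Reasoning
    -- the gcd cancelled when normalising x + (-1)
    g = gcd (↥ x ℤ.* ↧ (- 1ℚ) ℤ.+ ↥ (- 1ℚ) ℤ.* ↧ x) (↧ x ℤ.* ↧ (- 1ℚ))

  abs-negative-minus : ∀ a c → ℤ.∣ -[1+ a ] ℤ.- + c ∣ ≡ suc a ℕ.+ c
  abs-negative-minus a c = begin
    ℤ.∣ ℤ.- (+ suc a) ℤ.+ ℤ.- (+ c) ∣ ≡⟨ cong ℤ.∣_∣ (sym (ℤP.neg-distrib-+ (+ suc a) (+ c))) ⟩
    ℤ.∣ ℤ.- (+ suc a ℤ.+ + c) ∣        ≡⟨ ℤP.∣-i∣≡∣i∣ (+ suc a ℤ.+ + c) ⟩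
    ℤ.∣ + suc a ℤ.+ + c ∣              ≡⟨ cong ℤ.∣_∣ (sym (ℤP.pos-+ (suc a) c)) ⟩
    suc a ℕ.+ c                        ∎
    where open ≡-Reasoning

  expansion-over-ℕ : ∀ {p r a d} → ↥ r ≡ -[1+ a ] → IsPAdicExpansion p r d →
                     ∀ n → p ^ n ∣ suc a ℕ.+ ↧ₙ r ℕ.* partialSum p d n
  expansion-over-ℕ {p} {r} {a} {d} num≡ (_ , divs) n = subst (p ^ n ∣_) abs≡ (divs n)
    where
    S = partialSum p d n
    abs≡ : ℤ.∣ ↥ r ℤ.- (+ ↧ₙ r) ℤ.* (+ S) ∣ ≡ suc a ℕ.+ ↧ₙ r ℕ.* S
    abs≡ = trans (cong₂ (λ u v → ℤ.∣ u ℤ.- v ∣) num≡ (sym (ℤP.pos-* (↧ₙ r) S)))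
                 (abs-negative-minus a (↧ₙ r ℕ.* S))

  cross-order : ∀ {r s a b} → ↥ r ≡ -[1+ a ] → ↥ s ≡ -[1+ b ] → r < s →
                suc b ℕ.* ↧ₙ r ℕ.< suc a ℕ.* ↧ₙ s
  cross-order {r} {s} {a} {b} num-r num-s r<s =
    ℤP.drop‿+<+ (ℤP.neg-cancel-< (subst₂ ℤ._<_ (scaled r s num-r) (scaled s r num-s) (drop-*<* r<s)))
    where
    scaled : ∀ t u {c} → ↥ t ≡ -[1+ c ] → ↥ t ℤ.* ↧ u ≡ ℤ.- + (suc c ℕ.* ↧ₙ u)
    scaled t u {c} num≡ = trans (cong (ℤ._* ↧ u) num≡)
      (trans (sym (ℤP.neg-distribˡ-* (+ suc c) (↧ u))) (cong ℤ.-_ (sym (ℤP.pos-* (suc c) (↧ₙ u)))))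

  -- A rational r ∈ (-1, 0) whose reduced denominator B divides D, presented
  -- as r = -(1+a)/B with 1+a < B and D = q · B.  Then r = -k/D with k = q(1+a).
  record Deficit (D : ℕ) (r : ℚ) : Set where
    field
      a q       : ℕ
      numerator : ↥ r ≡ -[1+ a ]
      small     : suc a ℕ.< ↧ₙ r
      cofactor  : D ≡ q ℕ.* ↧ₙ r

    k : ℕ
    k = q ℕ.* suc a

  open Deficit using (k)

  deficit : ∀ {D} x → 0ℚ < x → x < 1ℚ → ↧ₙ x ∣ D → Deficit D (x - 1ℚ)
  deficit {D} x 0<x x<1 den∣D with negative-numerator (x - 1ℚ) (+-monoˡ-< (- 1ℚ) x<1)
  ... | a , num≡ = record
    { a         = a
    ; q         = _∣_.quotient B∣D
    ; numerator = num≡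
    ; small     = numerator-below-denominator (x - 1ℚ) (+-monoˡ-< (- 1ℚ) 0<x) num≡
    ; cofactor  = _∣_.equality B∣D
    }
    where
    B∣D : ↧ₙ (x - 1ℚ) ∣ D
    B∣D = ∣-trans (denominator-of-shift x) den∣D

  deficit-range : ∀ {D r} .{{_ : ℕ.NonZero D}} (δ : Deficit D r) → InRange D (k δ)
  deficit-range {D} {r} δ = ℕP.*-mono-≤ 1≤q (s≤s z≤n) , k≤D
    where
    open Deficit δ
    1≤q : 1 ℕ.≤ q
    1≤q = factor-positive (↧ₙ r) (trans (ℕP.*-comm (↧ₙ r) q) (sym cofactor)) (ℕ.>-nonZero⁻¹ D)
    k≤D : q ℕ.* suc a ℕ.≤ D
    k≤D = subst (q ℕ.* suc a ℕ.≤_) (sym cofactor) (ℕP.*-monoʳ-≤ q (ℕP.<⇒≤ small))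

  deficit-expansion : ∀ {p D r d} (δ : Deficit D r) → IsPAdicExpansion p r d →
                      ∀ n → p ^ n ∣ D ℕ.* partialSum p d n ℕ.+ k δ
  deficit-expansion {p} {D} {r} {d} δ expansion n =
    subst (p ^ n ∣_) scaled (∣n⇒∣m*n q (expansion-over-ℕ {r = r} numerator expansion n))
    where
    open Deficit δ
    S = partialSum p d n
    scaled : q ℕ.* (suc a ℕ.+ ↧ₙ r ℕ.* S) ≡ D ℕ.* S ℕ.+ q ℕ.* suc a
    scaled = begin
      q ℕ.* (suc a ℕ.+ ↧ₙ r ℕ.* S)      ≡⟨ solve 4 (λ q a B S → q :* (a :+ B :* S) := q :* B :* S :+ q :* a) refl q (suc a) (↧ₙ r) S ⟩
      q ℕ.* ↧ₙ r ℕ.* S ℕ.+ q ℕ.* suc a  ≡⟨ cong (λ e → e ℕ.* S ℕ.+ q ℕ.* suc a) (sym cofactor) ⟩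
      D ℕ.* S ℕ.+ q ℕ.* suc a           ∎
      where open ≡-Reasoning

  deficit-antitone : ∀ {D r s} .{{_ : ℕ.NonZero D}} → r < s → (δr : Deficit D r) (δs : Deficit D s) → k δs ℕ.< k δr
  deficit-antitone {D} {r} {s} r<s δr δs = ℕP.*-cancelʳ-< (Bᵣ ℕ.* Bₛ) (k δs) (k δr) (begin-strict
    qₛ ℕ.* suc aₛ ℕ.* (Bᵣ ℕ.* Bₛ)   ≡⟨ solve 4 (λ q a b c → q :* a :* (b :* c) := q :* c :* (a :* b)) refl qₛ (suc aₛ) Bᵣ Bₛ ⟩
    qₛ ℕ.* Bₛ ℕ.* (suc aₛ ℕ.* Bᵣ)   ≡⟨ cong (ℕ._* (suc aₛ ℕ.* Bᵣ)) (sym (Deficit.cofactor δs)) ⟩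
    D ℕ.* (suc aₛ ℕ.* Bᵣ)           <⟨ ℕP.*-monoʳ-< D cross ⟩
    D ℕ.* (suc aᵣ ℕ.* Bₛ)           ≡⟨ cong (ℕ._* (suc aᵣ ℕ.* Bₛ)) (Deficit.cofactor δr) ⟩
    qᵣ ℕ.* Bᵣ ℕ.* (suc aᵣ ℕ.* Bₛ)   ≡⟨ solve 4 (λ q b a c → q :* b :* (a :* c) := q :* a :* (b :* c)) refl qᵣ Bᵣ (suc aᵣ) Bₛ ⟩
    qᵣ ℕ.* suc aᵣ ℕ.* (Bᵣ ℕ.* Bₛ)   ∎)
    where
    open ℕP.≤-Reasoning
    open Deficit δr using () renaming (a to aᵣ; q to qᵣ)
    open Deficit δs using () renaming (a to aₛ; q to qₛ)
    Bᵣ = ↧ₙ r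
    Bₛ = ↧ₙ s
    cross : suc aₛ ℕ.* Bᵣ ℕ.< suc aᵣ ℕ.* Bₛ
    cross = cross-order (Deficit.numerator δr) (Deficit.numerator δs) r<s

open import Defs
open import Data.Nat using (ℕ; _>_)
open import Relation.Binary.PropositionalEquality using (_≢_)
open import Data.Nat.Primality using (Prime)
open import Data.Nat.LCM using (lcm)
open import Data.Rational using (ℚ; _<_; _-_; 0ℚ; 1ℚ; ↧ₙ_)

open import Data.Nat as ℕ using (NonZero; ≢-nonZero; ≢-nonZero⁻¹; >-nonZero)
import Data.Nat.Properties as ℕP
open import Data.Nat.GCD using (gcd)
open import Data.Nat.LCM using (m∣lcm[m,n]; n∣lcm[m,n]; gcd*lcm)
open import Data.Rational using (-_)
open import Data.Rational.Properties using (+-monoˡ-<; <-trans)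
open import Data.Product using (proj₁)
open import Relation.Binary.PropositionalEquality using (_≡_; sym; trans; cong)
open Carries using (common-digit⇒same-numerator)
open Deficits using (Deficit; deficit; deficit-range; deficit-expansion; deficit-antitone)

lcm-nonZero : ∀ m n .{{_ : NonZero m}} .{{_ : NonZero n}} → NonZero (lcm m n)
lcm-nonZero m n = ≢-nonZero λ lcm≡0 → ≢-nonZero⁻¹ (m ℕ.* n) {{ℕP.m*n≢0 m n}}
  (trans (sym (gcd*lcm m n)) (trans (cong (gcd m n ℕ.*_) lcm≡0) (ℕP.*-zeroʳ (gcd m n))))

lemma2p4 : (x y : ℚ) → 0ℚ < x → x < y → y < 1ℚ →
    (p : ℕ) → Prime p →
    IsPAdicUnit p (x - 1ℚ) → IsPAdicUnit p (y - 1ℚ) →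
    p > lcm (↧ₙ x) (↧ₙ y) →
    (xd yd : ℕ → ℕ) →
    IsPAdicExpansion p (x - 1ℚ) xd → IsPAdicExpansion p (y - 1ℚ) yd →
    ∀ j → xd j ≢ yd j
lemma2p4 x y 0<x x<y y<1 p _ _ _ D<p xd yd expx expy j xj≡yj =
  ℕP.<-irrefl (sym kₓ≡k_y) (deficit-antitone (+-monoˡ-< (- 1ℚ) x<y) δx δy)
  where
  D : ℕ
  D = lcm (↧ₙ x) (↧ₙ y)
  instance
    D≢0 : NonZero D
    D≢0 = lcm-nonZero (↧ₙ x) (↧ₙ y)
    p≢0 : NonZero p
    p≢0 = >-nonZero (ℕP.≤-<-trans ℕ.z≤n D<p)
  δx : Deficit D (x - 1ℚ)
  δx = deficit x 0<x (<-trans x<y y<1) (m∣lcm[m,n] (↧ₙ x) (↧ₙ y))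
  δy : Deficit D (y - 1ℚ)
  δy = deficit y (<-trans 0<x x<y) y<1 (n∣lcm[m,n] (↧ₙ x) (↧ₙ y))
  kₓ≡k_y : Deficit.k δx ≡ Deficit.k δy
  kₓ≡k_y = common-digit⇒same-numerator p D D<p (deficit-range δx) (deficit-range δy)
             (proj₁ expx) (proj₁ expy) (deficit-expansion δx expx) (deficit-expansion δy expy)
             j xj≡yj
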